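{- Let $G$ be a graph with an effective competition cover $\mathcal{C}$. Then every digraph $D$ accompanying $\mathcal{C}$ has exactly $p(G)$ vertices of in-degree $0$ (i.e., attains $p(G)$), and moreover $|V(D)| = p(G)+\theta_e(G)$ for every digraph $D$ accompanying $\mathcal{C}$.
   Context: All graphs are finite and simple; digraphs are finite, without loops or multiple arcs. A clique is a vertex set inducing a complete subgraph; it covers an edge if it contains both ends. The competition graph $C(D)$ of a digraph $D$ has vertex set $V(D)$, and distinct $x,y$ are adjacent iff some $z$ has arcs $(x,z),(y,z)$ in $D$. The competition number $k(G)$ is the smallest $k\ge0$ such that $G$ together with $k$ new isolated vertices is the competition graph of an acyclic digraph. The primary predator index $p(G)$ is the maximum, over all acyclic digraphs $D$ whose competition graph is $G$ together with $k(G)$ isolated vertices, of the number of in-degree-$0$ vertices of $D$. An edge clique cover is a family of cliques covering all edges; $\theta_e(G)$ is the minimum size of one; a minimum edge clique cover has size $\theta_e(G)$. For $G$ with at least one edge, a minimum edge clique cover $\mathcal{C}=\{C_1,\dots,C_{\theta_e(G)}\}$ is an effective competition cover if every $C_i$ is a maximal clique and there is an acyclic digraph $D$ whose competition graph is $G$ together with $k(G)$ isolated vertices, such that the set of vertices of nonzero in-degree of $D$ is $\{w_1,\dots,w_{\theta_e(G)}\}$ where each $w_i$ is a common out-neighbor of all vertices of $C_i$; any such $D$ is called a digraph accompanying $\mathcal{C}$. -}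

module Defs where

open import Data.Nat using (ℕ; zero; suc; _+_; _≤_)
open import Data.Fin using (Fin; zero; suc; splitAt; _↑ˡ_)
open import Data.Bool using (Bool; true; false; if_then_else_; _∧_)
open import Data.Sum using (inj₁; inj₂)
open import Data.Product using (Σ; ∃; _×_; _,_)
open import Relation.Binary.PropositionalEquality using (_≡_; _≢_)
open import Relation.Binary.Construct.Closure.Transitive using (TransClosure)
open import Relation.Nullary using (¬_)

record Graph : Set where
  field
    n      : ℕ
    adj    : Fin n → Fin n → Bool
    sym    : ∀ x y → adj x y ≡ adj y x
    irrefl : ∀ x → adj x x ≡ false
open Graph public

HasEdge : Graph → Set
HasEdge G = Σ (Fin (n G)) λ x → Σ (Fin (n G)) λ y → adj G x y ≡ true

VSet : Graph → Set
VSet G = Fin (n G) → Bool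

IsClique : (G : Graph) → VSet G → Set
IsClique G C = ∀ x y → x ≢ y → C x ≡ true → C y ≡ true → adj G x y ≡ true

IsMaximalClique : (G : Graph) → VSet G → Set
IsMaximalClique G C =
  IsClique G C ×
  (∀ (S : VSet G) → IsClique G S → (∀ x → C x ≡ true → S x ≡ true) →
     ∀ x → S x ≡ true → C x ≡ true)

IsEdgeCliqueCover : (G : Graph) (t : ℕ) → (Fin t → VSet G) → Set
IsEdgeCliqueCover G t C =
  (∀ i → IsClique G (C i)) ×
  (∀ x y → adj G x y ≡ true → Σ (Fin t) λ i → C i x ≡ true × C i y ≡ true)

IsThetaE : Graph → ℕ → Set
IsThetaE G θ =
  (Σ (Fin θ → VSet G) λ C → IsEdgeCliqueCover G θ C) ×
  (∀ t (C : Fin t → VSet G) → IsEdgeCliqueCover G t C → θ ≤ t)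

IsMinimumECC : (G : Graph) (t : ℕ) → (Fin t → VSet G) → Set
IsMinimumECC G t C = IsEdgeCliqueCover G t C × IsThetaE G t

record Digraph (m : ℕ) : Set where
  field
    arc      : Fin m → Fin m → Bool
    loopless : ∀ v → arc v v ≡ false
open Digraph public

Arc : ∀ {m} → Digraph m → Fin m → Fin m → Set
Arc D u v = arc D u v ≡ true

Acyclic : ∀ {m} → Digraph m → Set
Acyclic D = ∀ v → ¬ TransClosure (Arc D) v v

countTrue : ∀ {m} → (Fin m → Bool) → ℕ
countTrue {zero}  f = 0
countTrue {suc m} f = (if f zero then 1 else 0) + countTrue (λ i → f (suc i))

allTrue : ∀ {m} → (Fin m → Bool) → Bool
allTrue {zero}  f = true
allTrue {suc m} f = f zero ∧ allTrue (λ i → f (suc i))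

not′ : Bool → Bool
not′ true = false
not′ false = true

isSource : ∀ {m} → Digraph m → Fin m → Bool
isSource D v = allTrue (λ u → not′ (arc D u v))

sourceCount : ∀ {m} → Digraph m → ℕ
sourceCount D = countTrue (isSource D)

-- G together with k new isolated vertices, on Fin (n G + k):
-- vertex x of G is  x ↑ˡ k ; the new vertices are the remaining ones.

adjPlusIsolated : (G : Graph) (k : ℕ) → Fin (n G + k) → Fin (n G + k) → Bool
adjPlusIsolated G k x y with splitAt (n G) x | splitAt (n G) y
... | inj₁ a | inj₁ b = adj G a b
... | _      | _      = false

CompetitionGraphIs : (G : Graph) (k : ℕ) → Digraph (n G + k) → Set
CompetitionGraphIs G k D =
  ∀ x y → x ≢ y →
    ((Σ (Fin (n G + k)) λ z → Arc D x z × Arc D y z) → adjPlusIsolated G k x y ≡ true) ×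
    (adjPlusIsolated G k x y ≡ true → Σ (Fin (n G + k)) λ z → Arc D x z × Arc D y z)

Realizes : (G : Graph) (k : ℕ) → Digraph (n G + k) → Set
Realizes G k D = Acyclic D × CompetitionGraphIs G k D

IsCompetitionNumber : Graph → ℕ → Set
IsCompetitionNumber G k =
  (Σ (Digraph (n G + k)) λ D → Realizes G k D) ×
  (∀ k′ (D : Digraph (n G + k′)) → Realizes G k′ D → k ≤ k′)

IsPrimaryPredatorIndex : (G : Graph) (k : ℕ) → ℕ → Set
IsPrimaryPredatorIndex G k p =
  (Σ (Digraph (n G + k)) λ D → Realizes G k D × sourceCount D ≡ p) ×
  (∀ (D : Digraph (n G + k)) → Realizes G k D → sourceCount D ≤ p)

Accompanies : (G : Graph) (k t : ℕ) → (Fin t → VSet G) → Digraph (n G + k) → Set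
Accompanies G k t C D =
  Realizes G k D ×
  (Σ (Fin t → Fin (n G + k)) λ w →
     (∀ v → (Σ (Fin (n G + k)) λ u → Arc D u v) → Σ (Fin t) λ i → w i ≡ v) ×
     (∀ i → Σ (Fin (n G + k)) λ u → Arc D u (w i)) ×
     (∀ i x → C i x ≡ true → Arc D (x ↑ˡ k) (w i)))

IsEffectiveCompetitionCover : (G : Graph) (k t : ℕ) → (Fin t → VSet G) → Set
IsEffectiveCompetitionCover G k t C =
  HasEdge G ×
  IsMinimumECC G t C ×
  (∀ i → IsMaximalClique G (C i)) ×
  (Σ (Digraph (n G + k)) λ D → Accompanies G k t C D)

-- Let m = n G + k.  Every vertex of a digraph D on Fin m is either a source
-- or has an in-arc, so  sourceCount D + #(non-sources of D) = m.  The proof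
-- compares the number of non-sources of two kinds of digraphs with t = |C|:
--
--  * any D′ realizing G with k isolated vertices has at least t
--    non-sources, because the in-neighbourhoods (within G) of its
--    non-sources form an edge clique cover of G and C is minimum;
--  * an accompanying D has exactly t non-sources, namely w_1, …, w_t.  They
--    are distinct: if w_i = w_j with i ≠ j, then C_j lies in the
--    in-neighbourhood of w_i, a clique containing the maximal clique C_i,
--    so C_j ⊆ C_i and dropping C_j gives a smaller edge clique cover.
--
-- Hence sourceCount D = m − t ≥ sourceCount D′, and θ_e(G) = t.
module Submission where

open import Defs
open import Data.Nat using (ℕ; _+_)
open import Data.Fin using (Fin)
open import Data.Product using (_×_)
open import Relation.Binary.PropositionalEquality using (_≡_)

open import Data.Nat using (zero; suc; _≤_)
open import Data.Nat.Properties using (+-suc; ≤-antisym; ≤-trans; ≤-reflexive; +-monoʳ-≤; +-cancelʳ-≤; <-irrefl)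
open import Data.Fin using (zero; suc; _↑ˡ_; punchIn; punchOut; _≟_)
open import Data.Fin.Properties using (suc-injective; ↑ˡ-injective; splitAt-↑ˡ; punchIn-punchOut; injective⇒≤)
open import Data.Bool using (Bool; true; false)
open import Data.Product using (Σ; _,_; proj₁; proj₂)
open import Data.Empty using (⊥-elim)
open import Function.Definitions using (Injective)
open import Relation.Nullary using (¬_; yes; no)
open import Relation.Binary.PropositionalEquality using (refl; trans; cong; subst; _≢_; module ≡-Reasoning) renaming (sym to ≡-sym)

countTrue-complement : ∀ {m} (g : Fin m → Bool) →
  countTrue g + countTrue (λ v → not′ (g v)) ≡ m
countTrue-complement {zero}  g = refl
countTrue-complement {suc m} g with g zero | countTrue-complement (λ i → g (suc i))
... | true  | rest = cong suc rest
... | false | rest = trans (+-suc _ _) (cong suc rest)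

-- A listing, without repetitions, of exactly the v with g v ≡ true; it is
-- indexed by Fin (countTrue g), which is what makes countTrue a cardinality.
record Enumeration {m} (g : Fin m → Bool) (c : ℕ) : Set where
  field
    index     : Fin c → Fin m
    injective : Injective _≡_ _≡_ index
    sound     : ∀ j → g (index j) ≡ true
    complete  : ∀ v → g v ≡ true → Σ (Fin c) λ j → index j ≡ v
open Enumeration

enumerate : ∀ {m} (g : Fin m → Bool) → Enumeration g (countTrue g)
enumerate {zero} g = record
  { index = λ () ; injective = λ { {()} } ; sound = λ () ; complete = λ () }
enumerate {suc m} g with enumerate (λ i → g (suc i)) | g zero in g0
... | E | true = record
  { index = listed ; injective = listed-inj ; sound = listed-sound ; complete = listed-complete }
  where
  listed : Fin (suc (countTrue (λ i → g (suc i)))) → Fin (suc m)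
  listed zero    = zero
  listed (suc j) = suc (index E j)
  listed-inj : Injective _≡_ _≡_ listed
  listed-inj {zero}  {zero}  _  = refl
  listed-inj {suc x} {suc y} eq = cong suc (injective E (suc-injective eq))
  listed-sound : ∀ j → g (listed j) ≡ true
  listed-sound zero    = g0
  listed-sound (suc j) = sound E j
  listed-complete : ∀ v → g v ≡ true → Σ _ λ j → listed j ≡ v
  listed-complete zero    _  = zero , refl
  listed-complete (suc v) gv with complete E v gv
  ... | j , eq = suc j , cong suc eq
... | E | false = record
  { index = listed ; injective = listed-inj ; sound = sound E ; complete = listed-complete }
  where
  listed : Fin (countTrue (λ i → g (suc i))) → Fin (suc m)
  listed j = suc (index E j)
  listed-inj : Injective _≡_ _≡_ listed
  listed-inj eq = injective E (suc-injective eq)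
  listed-complete : ∀ v → g v ≡ true → Σ _ λ j → listed j ≡ v
  listed-complete zero    gv with () ← trans (≡-sym g0) gv
  listed-complete (suc v) gv with complete E v gv
  ... | j , eq = j , cong suc eq

countTrue-≤-image : ∀ {m t} (g : Fin m → Bool) (w : Fin t → Fin m) →
  (∀ v → g v ≡ true → Σ (Fin t) λ i → w i ≡ v) → countTrue g ≤ t
countTrue-≤-image g w onto = injective⇒≤ preimage-inj
  where
  E = enumerate g
  preimage : Fin (countTrue g) → Fin _
  preimage j = proj₁ (onto (index E j) (sound E j))
  preimage-inj : Injective _≡_ _≡_ preimage
  preimage-inj {x} {y} eq = injective E (begin
    index E x             ≡⟨ ≡-sym (proj₂ (onto (index E x) (sound E x))) ⟩
    w (preimage x)        ≡⟨ cong w eq ⟩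
    w (preimage y)        ≡⟨ proj₂ (onto (index E y) (sound E y)) ⟩
    index E y             ∎)
    where open ≡-Reasoning

countTrue-≥-injection : ∀ {m t} (g : Fin m → Bool) (w : Fin t → Fin m) →
  Injective _≡_ _≡_ w → (∀ i → g (w i) ≡ true) → t ≤ countTrue g
countTrue-≥-injection g w w-inj g∘w = injective⇒≤ rank-inj
  where
  E = enumerate g
  rank : Fin _ → Fin (countTrue g)
  rank i = proj₁ (complete E (w i) (g∘w i))
  rank-inj : Injective _≡_ _≡_ rank
  rank-inj {x} {y} eq = w-inj (begin
    w x                   ≡⟨ ≡-sym (proj₂ (complete E (w x) (g∘w x))) ⟩
    index E (rank x)      ≡⟨ cong (index E) eq ⟩
    index E (rank y)      ≡⟨ proj₂ (complete E (w y) (g∘w y)) ⟩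
    w y                   ∎)
    where open ≡-Reasoning

allTrue-false→witness : ∀ {m} (f : Fin m → Bool) → allTrue f ≡ false →
  Σ (Fin m) λ i → f i ≡ false
allTrue-false→witness {suc m} f all≡false with f zero in f0
... | false = zero , f0
... | true with allTrue-false→witness (λ i → f (suc i)) all≡false
...   | i , fi = suc i , fi

witness→allTrue-false : ∀ {m} (f : Fin m → Bool) (i : Fin m) → f i ≡ false →
  allTrue f ≡ false
witness→allTrue-false f zero    fi rewrite fi = refl
witness→allTrue-false f (suc i) fi with f zero
... | true  = witness→allTrue-false (λ i → f (suc i)) i fi
... | false = refl

hasInArc : ∀ {m} → Digraph m → Fin m → Bool
hasInArc D v = not′ (isSource D v)

hasInArc-sound : ∀ {m} (D : Digraph m) v → hasInArc D v ≡ true →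
  Σ (Fin m) λ u → Arc D u v
hasInArc-sound D v has with isSource D v in src
... | false with allTrue-false→witness (λ u → not′ (arc D u v)) src
...   | u , no-arc = u , not′-false no-arc
  where
  not′-false : ∀ {b} → not′ b ≡ false → b ≡ true
  not′-false {true} _ = refl

hasInArc-complete : ∀ {m} (D : Digraph m) v → Σ (Fin m) (λ u → Arc D u v) →
  hasInArc D v ≡ true
hasInArc-complete D v (u , uv)
  rewrite witness→allTrue-false (λ u → not′ (arc D u v)) u (cong not′ uv) = refl

sources+nonsources : ∀ {m} (D : Digraph m) → sourceCount D + countTrue (hasInArc D) ≡ m
sources+nonsources D = countTrue-complement (isSource D)

nonsources-exactly : ∀ {m t} (D : Digraph m) (w : Fin t → Fin m) →
  (∀ v → Σ (Fin m) (λ u → Arc D u v) → Σ (Fin t) λ i → w i ≡ v) →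
  Injective _≡_ _≡_ w → (∀ i → Σ (Fin m) λ u → Arc D u (w i)) →
  countTrue (hasInArc D) ≡ t
nonsources-exactly D w covers w-inj w-has-in = ≤-antisym
  (countTrue-≤-image (hasInArc D) w (λ v has → covers v (hasInArc-sound D v has)))
  (countTrue-≥-injection (hasInArc D) w w-inj (λ i → hasInArc-complete D (w i) (w-has-in i)))

drop-redundant : ∀ {G t} (C : Fin (suc t) → VSet G) → IsEdgeCliqueCover G (suc t) C →
  ∀ i j → i ≢ j → (∀ x → C j x ≡ true → C i x ≡ true) →
  IsEdgeCliqueCover G t (λ l → C (punchIn j l))
drop-redundant {G} C (cliques , covers) i j i≢j Cj⊆Ci =
  (λ l → cliques (punchIn j l)) , covers′
  where
  covering-survivor : ∀ x y → adj G x y ≡ true →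
    Σ (Fin _) λ l → j ≢ l × C l x ≡ true × C l y ≡ true
  covering-survivor x y xy with covers x y xy
  ... | l , Clx , Cly with l ≟ j
  ...   | yes refl = i , (λ j≡i → i≢j (≡-sym j≡i)) , Cj⊆Ci x Clx , Cj⊆Ci y Cly
  ...   | no l≢j   = l , (λ j≡l → l≢j (≡-sym j≡l)) , Clx , Cly
  covers′ : ∀ x y → adj G x y ≡ true →
    Σ (Fin _) λ l → C (punchIn j l) x ≡ true × C (punchIn j l) y ≡ true
  covers′ x y xy with covering-survivor x y xy
  ... | l , j≢l , Clx , Cly rewrite ≡-sym (punchIn-punchOut j≢l) = punchOut j≢l , Clx , Cly

minimum-cover-irredundant : ∀ {G t} (C : Fin t → VSet G) → IsEdgeCliqueCover G t C →
  (∀ t′ (C′ : Fin t′ → VSet G) → IsEdgeCliqueCover G t′ C′ → t ≤ t′) →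
  ∀ i j → i ≢ j → ¬ (∀ x → C j x ≡ true → C i x ≡ true)
minimum-cover-irredundant {G} {suc t} C cover minimum i j i≢j Cj⊆Ci =
  <-irrefl refl (minimum t (λ l → C (punchIn j l)) (drop-redundant {G} C cover i j i≢j Cj⊆Ci))

preyOf : (G : Graph) (k : ℕ) → Digraph (n G + k) → Fin (n G + k) → VSet G
preyOf G k D z x = arc D (x ↑ˡ k) z

adjPlusIsolated-↑ˡ : (G : Graph) (k : ℕ) (x y : Fin (n G)) →
  adjPlusIsolated G k (x ↑ˡ k) (y ↑ˡ k) ≡ adj G x y
adjPlusIsolated-↑ˡ G k x y rewrite splitAt-↑ˡ (n G) x k | splitAt-↑ˡ (n G) y k = refl

adj-irreflexive : (G : Graph) (x y : Fin (n G)) → adj G x y ≡ true → x ≢ y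
adj-irreflexive G x .x xx refl with () ← trans (≡-sym (irrefl G x)) xx

-- Vertices of G with a common out-neighbour compete, so preyOf z is a clique.
preyOf-clique : ∀ {G k} (D : Digraph (n G + k)) → CompetitionGraphIs G k D →
  ∀ z → IsClique G (preyOf G k D z)
preyOf-clique {G} {k} D compete z x y x≢y xz yz = begin
  adj G x y                              ≡⟨ ≡-sym (adjPlusIsolated-↑ˡ G k x y) ⟩
  adjPlusIsolated G k (x ↑ˡ k) (y ↑ˡ k)  ≡⟨ proj₁ (compete _ _ lifted-≢) (z , xz , yz) ⟩
  true                                   ∎
  where
  open ≡-Reasoning
  lifted-≢ : x ↑ˡ k ≢ y ↑ˡ k
  lifted-≢ eq = x≢y (↑ˡ-injective k x y eq)

edge-commonPrey : ∀ {G k} (D : Digraph (n G + k)) → CompetitionGraphIs G k D →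
  ∀ x y → adj G x y ≡ true → Σ (Fin (n G + k)) λ z → Arc D (x ↑ˡ k) z × Arc D (y ↑ˡ k) z
edge-commonPrey {G} {k} D compete x y xy =
  proj₂ (compete _ _ lifted-≢) (trans (adjPlusIsolated-↑ˡ G k x y) xy)
  where
  lifted-≢ : x ↑ˡ k ≢ y ↑ˡ k
  lifted-≢ eq = adj-irreflexive G x y xy (↑ˡ-injective k x y eq)

-- The prey sets of the non-sources of D form an edge clique cover of G, so
-- D has at least θ non-sources whenever θ bounds every cover from below.
nonsources-≥-cover : ∀ {G k} (θ : ℕ) →
  (∀ t′ (C′ : Fin t′ → VSet G) → IsEdgeCliqueCover G t′ C′ → θ ≤ t′) →
  (D : Digraph (n G + k)) → CompetitionGraphIs G k D → θ ≤ countTrue (hasInArc D)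
nonsources-≥-cover {G} {k} θ minimum D compete =
  minimum _ (λ j → preyOf G k D (index E j)) (cliques , covers)
  where
  E = enumerate (hasInArc D)
  cliques : ∀ j → IsClique G (preyOf G k D (index E j))
  cliques j = preyOf-clique D compete (index E j)
  covers : ∀ x y → adj G x y ≡ true →
    Σ (Fin _) λ j → preyOf G k D (index E j) x ≡ true × preyOf G k D (index E j) y ≡ true
  covers x y xy with edge-commonPrey D compete x y xy
  ... | z , xz , yz with complete E z (hasInArc-complete D z (_ , xz))
  ...   | j , refl = j , xz , yz

-- For a minimum cover by maximal cliques, distinct cliques cannot share a
-- common out-neighbour: otherwise C j ⊆ preyOf (w i) ⊆ C i, the last by
-- maximality of C i, contradicting irredundance.
commonPrey-injective : ∀ {G k t} (D : Digraph (n G + k)) → CompetitionGraphIs G k D →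
  (C : Fin t → VSet G) → IsEdgeCliqueCover G t C →
  (∀ t′ (C′ : Fin t′ → VSet G) → IsEdgeCliqueCover G t′ C′ → t ≤ t′) →
  (∀ i → IsMaximalClique G (C i)) →
  (w : Fin t → Fin (n G + k)) → (∀ i x → C i x ≡ true → Arc D (x ↑ˡ k) (w i)) →
  Injective _≡_ _≡_ w
commonPrey-injective {G} {k} D compete C cover minimum maximal w preys {i} {j} wi≡wj
  with i ≟ j
... | yes i≡j = i≡j
... | no  i≢j = ⊥-elim (minimum-cover-irredundant {G} C cover minimum i j i≢j Cj⊆Ci)
  where
  Cj⊆Ci : ∀ x → C j x ≡ true → C i x ≡ true
  Cj⊆Ci x Cjx = proj₂ (maximal i) (preyOf G k D (w i)) (preyOf-clique D compete (w i))
    (preys i) x (subst (λ z → Arc D (x ↑ˡ k) z) (≡-sym wi≡wj) (preys j x Cjx))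

proposition3p5 : (G : Graph) (k : ℕ) → IsCompetitionNumber G k →
    (t : ℕ) (C : Fin t → VSet G) → IsEffectiveCompetitionCover G k t C →
    (D : Digraph (n G + k)) → Accompanies G k t C D →
    IsPrimaryPredatorIndex G k (sourceCount D) ×
    (∀ θ → IsThetaE G θ → n G + k ≡ sourceCount D + θ)
proposition3p5 G k _ t C (_ , (cover , (_ , minimum)) , maximal , _)
               D (realizes@(_ , compete) , w , covers , w-has-in , preys) =
  ((D , realizes , refl) , maximum) , size
  where
  w-injective = commonPrey-injective D compete C cover minimum maximal w preys
  D-sources : sourceCount D + t ≡ n G + k
  D-sources = trans (cong (sourceCount D +_) (≡-sym (nonsources-exactly D w covers w-injective w-has-in)))
                    (sources+nonsources D)
  maximum : ∀ (D′ : Digraph (n G + k)) → Realizes G k D′ → sourceCount D′ ≤ sourceCount D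
  maximum D′ (_ , compete′) = +-cancelʳ-≤ t _ _ (≤-trans
    (+-monoʳ-≤ (sourceCount D′) (nonsources-≥-cover t minimum D′ compete′))
    (≤-reflexive (trans (sources+nonsources D′) (≡-sym D-sources))))
  size : ∀ θ → IsThetaE G θ → n G + k ≡ sourceCount D + θ
  size θ ((Cθ , coverθ) , minimumθ) =
    trans (≡-sym D-sources) (cong (sourceCount D +_) (≤-antisym (minimum θ Cθ coverθ) (minimumθ t C cover)))
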